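{- Let $n\ge3$ be an integer and let $f$ be a $\gamma_{tr3}(P_3\square P_n)$-function such that the number of vertices $v$ with $f(v)=\emptyset$ is minimum among all $\gamma_{tr3}(P_3\square P_n)$-functions. Then $|f((i,j))|\le2$ for all $i\in\{0,1\}$ and $j\in\{0,1,\dots,n-1\}$.
   Context: $P_m$ denotes the directed path with vertex set $\{0,1,\dots,m-1\}$ and arcs $(i,i+1)$ for $0\le i\le m-2$. The Cartesian product $D_1\square D_2$ has vertex set $V(D_1)\times V(D_2)$, with an arc from $(x_1,y_1)$ to $(x_2,y_2)$ iff either $(x_1,x_2)$ is an arc of $D_1$ and $y_1=y_2$, or $x_1=x_2$ and $(y_1,y_2)$ is an arc of $D_2$; so vertices of $P_3\square P_n$ are $(i,j)$ with $i\in\{0,1,2\}$, $j\in\{0,\dots,n-1\}$. For a digraph $D$ and positive integer $k$, a $k$RDF is a function $f:V(D)\to\mathcal{P}(\{1,\dots,k\})$ such that every $v$ with $f(v)=\emptyset$ satisfies $\bigcup_{u\in N^-(v)}f(u)=\{1,\dots,k\}$ ($N^-(v)$ the in-neighbors of $v$); its weight is $\sum_v|f(v)|$. A T$k$RDF is a $k$RDF $f$ such that the subdigraph induced by $\{v:f(v)\neq\emptyset\}$ has no isolated vertex; $\gamma_{trk}(D)$ is the minimum weight of a T$k$RDF, and a T$k$RDF of that weight is a $\gamma_{trk}(D)$-function. -}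

module Defs where

open import Data.Nat using (ℕ; zero; suc; _+_; _≤_)
open import Data.Fin using (Fin; toℕ)
open import Data.Fin.Subset using (Subset; ∣_∣; _∈_)
open import Data.List using (List; map; allFin; cartesianProduct)
open import Data.Nat.ListAction using (sum)
open import Data.Product using (_×_; _,_; Σ; ∃-syntax)
open import Data.Sum using (_⊎_)
open import Relation.Binary.PropositionalEquality using (_≡_)
open import Relation.Nullary using (¬_)

-- A finite digraph: a vertex type, a list enumerating all vertices
-- (each exactly once), and an arc relation.
record Digraph : Set₁ where
  field
    V     : Set
    verts : List V
    Arc   : V → V → Set
open Digraph public

P : ℕ → Digraph
P m = record
  { V     = Fin m
  ; verts = allFin m
  ; Arc   = λ i j → toℕ j ≡ suc (toℕ i)
  }

_□_ : Digraph → Digraph → Digraph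
D₁ □ D₂ = record
  { V     = V D₁ × V D₂
  ; verts = cartesianProduct (verts D₁) (verts D₂)
  ; Arc   = λ { (x₁ , y₁) (x₂ , y₂) →
              (Arc D₁ x₁ x₂ × y₁ ≡ y₂) ⊎ (x₁ ≡ x₂ × Arc D₂ y₁ y₂) }
  }

-- labellings with subsets of {1,…,k} (represented as Fin k)
Labelling : Digraph → ℕ → Set
Labelling D k = V D → Subset k

Empty : ∀ {k} → Subset k → Set
Empty s = ∣ s ∣ ≡ 0

IsKRDF : (D : Digraph) (k : ℕ) → Labelling D k → Set
IsKRDF D k f = ∀ v → Empty (f v) → ∀ (c : Fin k) → ∃[ u ] (Arc D u v × c ∈ f u)

IsTotal : (D : Digraph) (k : ℕ) → Labelling D k → Set
IsTotal D k f = ∀ v → ¬ Empty (f v) →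
  ∃[ u ] (¬ Empty (f u) × (Arc D u v ⊎ Arc D v u))

IsTkRDF : (D : Digraph) (k : ℕ) → Labelling D k → Set
IsTkRDF D k f = IsKRDF D k f × IsTotal D k f

weight : (D : Digraph) (k : ℕ) → Labelling D k → ℕ
weight D k f = sum (map (λ v → ∣ f v ∣) (verts D))

emptyIndicator : ℕ → ℕ
emptyIndicator zero    = 1
emptyIndicator (suc _) = 0

emptyCount : (D : Digraph) (k : ℕ) → Labelling D k → ℕ
emptyCount D k f = sum (map (λ v → emptyIndicator ∣ f v ∣) (verts D))

IsGammaTrkFunction : (D : Digraph) (k : ℕ) → Labelling D k → Set
IsGammaTrkFunction D k f =
  IsTkRDF D k f × (∀ g → IsTkRDF D k g → weight D k f ≤ weight D k g)

-- If |f v| = 3, replace f v by {1} and give {1} to every empty out-neighbour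
-- of v. This is again a total 3-Roman dominating function: v keeps the
-- nonempty out-neighbour (i+1, j), and the vertices that stay empty lose no
-- in-neighbour labels. Since v has at most two out-neighbours, the weight does
-- not grow, so it is again a γ_tr3-function; but weight plus number of empty
-- vertices drops by 2, so it has fewer empty vertices than f.
module Submission where

open import Defs
open import Data.Nat using (ℕ; suc; _+_; _*_; _≤_; _<_; z≤n; s≤s; _≤?_)
open import Data.Nat.Properties
open import Data.Fin using (Fin; toℕ; fromℕ<) renaming (zero to fzero; _≟_ to _≟ᶠ_)
open import Data.Fin.Properties using (toℕ-injective; toℕ-fromℕ<)
open import Data.Fin.Subset using (Subset; ∣_∣; ⁅_⁆; _∈_)
open import Data.Fin.Subset.Properties using (∣⁅x⁆∣≡1; ∣⊥∣≡0; p⊆q⇒∣p∣≤∣q∣; x∈⁅x⁆; x∈⁅y⁆⇒x≡y)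
open import Data.List using (List; []; _∷_; map)
open import Data.List.Membership.Propositional using () renaming (_∈_ to _∈ˡ_)
open import Data.List.Membership.Propositional.Properties using (∈-allFin; ∈-cartesianProduct⁺)
open import Data.List.Relation.Unary.All as All using (All; []; _∷_)
open import Data.List.Relation.Unary.Any using (here; there)
open import Data.List.Relation.Unary.AllPairs using ([]; _∷_)
open import Data.List.Relation.Unary.Unique.Propositional using (Unique)
open import Data.List.Relation.Unary.Unique.Propositional.Properties using (allFin⁺; cartesianProduct⁺)
open import Data.Nat.ListAction using (sum)
open import Data.Product using (_×_; _,_; ∃-syntax)
open import Data.Product.Properties using (≡-dec)
open import Data.Sum using (_⊎_; inj₁; inj₂)
open import Data.Empty using (⊥-elim)
open import Function using (_∘_)
open import Algebra.Properties.CommutativeSemigroup +-commutativeSemigroup using (interchange)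
open import Relation.Binary.Definitions using (DecidableEquality)
open import Relation.Nullary using (¬_; Dec; yes; no; _×-dec_; _⊎-dec_)
open import Relation.Nullary.Decidable using (decidable-stable)
open import Relation.Unary using (Pred; Decidable)
open import Relation.Binary.PropositionalEquality

private
  variable
    A X Y : Set

∑ : List A → (A → ℕ) → ℕ
∑ xs h = sum (map h xs)

∑-mono-≤ : (xs : List A) {a b : A → ℕ} → (∀ u → a u ≤ b u) → ∑ xs a ≤ ∑ xs b
∑-mono-≤ []       a≤b = z≤n
∑-mono-≤ (x ∷ xs) a≤b = +-mono-≤ (a≤b x) (∑-mono-≤ xs a≤b)

∑-distrib-+ : (xs : List A) (a b : A → ℕ) → ∑ xs (λ u → a u + b u) ≡ ∑ xs a + ∑ xs b
∑-distrib-+ []       a b = refl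
∑-distrib-+ (x ∷ xs) a b = trans (cong (a x + b x +_) (∑-distrib-+ xs a b))
  (interchange (a x) (b x) (∑ xs a) (∑ xs b))

∈⇒≤∑ : {xs : List A} {v : A} (h : A → ℕ) → v ∈ˡ xs → h v ≤ ∑ xs h
∈⇒≤∑ h (here refl) = m≤m+n _ _
∈⇒≤∑ {xs = x ∷ _} h (there v∈xs) = ≤-trans (∈⇒≤∑ h v∈xs) (m≤n+m _ (h x))

∑-≤-bonus : (xs : List A) {a b c : A → ℕ} {v : A} →
  (∀ u → a u + c u ≤ b u) → v ∈ˡ xs → ∑ xs a + c v ≤ ∑ xs b
∑-≤-bonus xs {a} {b} {c} {v} a+c≤b v∈xs = begin
  ∑ xs a + c v                ≤⟨ +-monoʳ-≤ (∑ xs a) (∈⇒≤∑ c v∈xs) ⟩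
  ∑ xs a + ∑ xs c             ≡⟨ ∑-distrib-+ xs a c ⟨
  ∑ xs (λ u → a u + c u)      ≤⟨ ∑-mono-≤ xs a+c≤b ⟩
  ∑ xs b                      ∎
  where open ≤-Reasoning

𝟙 : Dec X → ℕ
𝟙 (yes _) = 1
𝟙 (no _)  = 0

𝟙-yes : (p? : Dec X) → X → 𝟙 p? ≡ 1
𝟙-yes (yes _) _  = refl
𝟙-yes (no ¬p) p = ⊥-elim (¬p p)

𝟙-⊎-dec : (p? : Dec X) (q? : Dec Y) → 𝟙 (p? ⊎-dec q?) ≤ 𝟙 p? + 𝟙 q?
𝟙-⊎-dec (yes _) _       = s≤s z≤n
𝟙-⊎-dec (no _)  (yes _) = s≤s z≤n
𝟙-⊎-dec (no _)  (no _)  = z≤n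

∑-𝟙-none : {R : Pred A _} (R? : Decidable R) {xs : List A} →
  All (¬_ ∘ R) xs → ∑ xs (𝟙 ∘ R?) ≡ 0
∑-𝟙-none R? [] = refl
∑-𝟙-none R? {x ∷ _} (¬Rx ∷ rest) with R? x
... | yes Rx = ⊥-elim (¬Rx Rx)
... | no  _  = ∑-𝟙-none R? rest

∑-𝟙-unique≤1 : {R : Pred A _} (R? : Decidable R) → (∀ {x y} → R x → R y → x ≡ y) →
  {xs : List A} → Unique xs → ∑ xs (𝟙 ∘ R?) ≤ 1
∑-𝟙-unique≤1 R? R-unique [] = z≤n
∑-𝟙-unique≤1 R? R-unique {x ∷ xs} (x∉xs ∷ unique-xs) with R? x
... | yes Rx = ≤-reflexive (cong suc
      (∑-𝟙-none R? (All.map (λ {y} x≢y Ry → x≢y (R-unique Rx Ry)) x∉xs)))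
... | no  _  = ∑-𝟙-unique≤1 R? R-unique unique-xs

∈⇒nonempty : ∀ {k} {c : Fin k} {s : Subset k} → c ∈ s → ¬ Empty s
∈⇒nonempty {c = c} {s} c∈s s-empty = 1≰0 (begin
  1         ≡⟨ ∣⁅x⁆∣≡1 c ⟨
  ∣ ⁅ c ⁆ ∣ ≤⟨ p⊆q⇒∣p∣≤∣q∣ (λ x∈⁅c⁆ → subst (_∈ s) (sym (x∈⁅y⁆⇒x≡y c x∈⁅c⁆)) c∈s) ⟩
  ∣ s ∣     ≡⟨ s-empty ⟩
  0         ∎)
  where
  open ≤-Reasoning
  1≰0 : ¬ 1 ≤ 0
  1≰0 ()

singleton-nonempty : ∀ {k} (c : Fin k) → ¬ Empty ⁅ c ⁆
singleton-nonempty c = ∈⇒nonempty (x∈⁅x⁆ c)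

weight+emptyCount-minimal : (D : Digraph) (k : ℕ) {f g : Labelling D k} →
  IsGammaTrkFunction D k f →
  (∀ h → IsGammaTrkFunction D k h → emptyCount D k f ≤ emptyCount D k h) →
  IsTkRDF D k g → weight D k g ≤ weight D k f →
  weight D k f + emptyCount D k f ≤ weight D k g + emptyCount D k g
weight+emptyCount-minimal D k (_ , f-min) f-fewest g-total g≤f =
  +-mono-≤ (f-min _ g-total) (f-fewest _ (g-total , λ h h-total → ≤-trans g≤f (f-min h h-total)))

module Transfer (D : Digraph) (_≟ᵥ_ : DecidableEquality (V D))
                (arc? : ∀ u w → Dec (Arc D u w))
                {k : ℕ} (f : Labelling D (suc k)) (v : V D) where

  transfer : Labelling D (suc k)
  transfer u with u ≟ᵥ v | arc? v u ×-dec (∣ f u ∣ ≟ 0)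
  ... | yes _ | _     = ⁅ fzero ⁆
  ... | no _  | yes _ = ⁅ fzero ⁆
  ... | no _  | no _  = f u

  transfer-at : transfer v ≡ ⁅ fzero ⁆
  transfer-at with v ≟ᵥ v
  ... | yes _  = refl
  ... | no v≢v = ⊥-elim (v≢v refl)

  transfer-at-nonempty : ¬ Empty (transfer v)
  transfer-at-nonempty = subst (¬_ ∘ Empty) (sym transfer-at) (singleton-nonempty (fzero {k}))

  𝟙[v≟v]≡1 : 𝟙 (v ≟ᵥ v) ≡ 1
  𝟙[v≟v]≡1 = 𝟙-yes (v ≟ᵥ v) refl

  transfer-elsewhere : ∀ {u} → u ≢ v → ¬ Empty (f u) → transfer u ≡ f u
  transfer-elsewhere {u} u≢v fu-nonempty with u ≟ᵥ v | arc? v u ×-dec (∣ f u ∣ ≟ 0)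
  ... | yes u≡v | _                    = ⊥-elim (u≢v u≡v)
  ... | no _    | yes (_ , fu-empty)   = ⊥-elim (fu-nonempty fu-empty)
  ... | no _    | no _                 = refl

  transfer-out : ∀ {u} → Arc D v u → ¬ Empty (transfer u)
  transfer-out {u} v→u with u ≟ᵥ v | arc? v u ×-dec (∣ f u ∣ ≟ 0)
  ... | yes _ | _     = singleton-nonempty (fzero {k})
  ... | no _  | yes _ = singleton-nonempty (fzero {k})
  ... | no _  | no ¬[v→u×fu-empty] = λ fu-empty → ¬[v→u×fu-empty] (v→u , fu-empty)

  transfer-nonempty : ∀ {u} → ¬ Empty (f u) → ¬ Empty (transfer u)
  transfer-nonempty {u} fu-nonempty = by-cases (u ≟ᵥ v)
    where
    by-cases : Dec (u ≡ v) → ¬ Empty (transfer u)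
    by-cases (yes refl) = transfer-at-nonempty
    by-cases (no u≢v)   = subst (¬_ ∘ Empty) (sym (transfer-elsewhere u≢v fu-nonempty)) fu-nonempty

  transfer-filled : ∀ {u} → u ≢ v → Empty (f u) → ¬ Empty (transfer u) → Arc D v u
  transfer-filled {u} u≢v fu-empty tu-nonempty with u ≟ᵥ v | arc? v u ×-dec (∣ f u ∣ ≟ 0)
  ... | yes u≡v | _              = ⊥-elim (u≢v u≡v)
  ... | no _    | yes (v→u , _)  = v→u
  ... | no _    | no _           = ⊥-elim (tu-nonempty fu-empty)

  transfer-empty : ∀ {u} → Empty (transfer u) → u ≢ v × ¬ Arc D v u × Empty (f u)
  transfer-empty {u} tu-empty =
      (λ { refl → transfer-at-nonempty tu-empty })
    , (λ v→u → transfer-out v→u tu-empty)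
    , decidable-stable (∣ f u ∣ ≟ 0) (λ fu-nonempty → transfer-nonempty fu-nonempty tu-empty)

  transfer-isKRDF : IsKRDF D (suc k) f → IsKRDF D (suc k) transfer
  transfer-isKRDF f-rdf u tu-empty c with transfer-empty tu-empty
  ... | _ , ¬v→u , fu-empty with f-rdf u fu-empty c
  ... | w , w→u , c∈fw =
    w , w→u , subst (c ∈_) (sym (transfer-elsewhere w≢v (∈⇒nonempty c∈fw))) c∈fw
    where
    w≢v : w ≢ v
    w≢v refl = ¬v→u w→u

  transfer-isTotal : IsTotal D (suc k) f → ∀ {w} → Arc D v w → IsTotal D (suc k) transfer
  transfer-isTotal f-total {w} v→w u tu-nonempty = by-cases (u ≟ᵥ v) (∣ f u ∣ ≟ 0)
    where
    by-cases : Dec (u ≡ v) → Dec (Empty (f u)) →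
      ∃[ x ] (¬ Empty (transfer x) × (Arc D x u ⊎ Arc D u x))
    by-cases (yes refl) _              = w , transfer-out v→w , inj₂ v→w
    by-cases (no u≢v)   (yes fu-empty) =
      v , transfer-at-nonempty , inj₁ (transfer-filled u≢v fu-empty tu-nonempty)
    by-cases (no _)     (no fu-nonempty) with f-total u fu-nonempty
    ... | x , fx-nonempty , adjacent = x , transfer-nonempty fx-nonempty , adjacent

  transfer-size : 3 ≤ ∣ f v ∣ → ∀ u → ∣ transfer u ∣ + 2 * 𝟙 (u ≟ᵥ v) ≤ ∣ f u ∣ + 𝟙 (arc? v u)
  transfer-size 3≤fv u with u ≟ᵥ v | arc? v u ×-dec (∣ f u ∣ ≟ 0)
  ... | yes refl | _ rewrite ∣⊥∣≡0 k = m≤n⇒m≤n+o _ 3≤fv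
  ... | no _     | yes (v→u , fu-empty)
    rewrite ∣⊥∣≡0 k | fu-empty | 𝟙-yes (arc? v u) v→u = ≤-refl
  ... | no _     | no _ = +-monoʳ-≤ ∣ f u ∣ z≤n

  cost : Subset (suc k) → ℕ
  cost s = ∣ s ∣ + emptyIndicator ∣ s ∣

  transfer-cost : 3 ≤ ∣ f v ∣ → ∀ u → cost (transfer u) + 2 * 𝟙 (u ≟ᵥ v) ≤ cost (f u)
  transfer-cost 3≤fv u with u ≟ᵥ v | arc? v u ×-dec (∣ f u ∣ ≟ 0)
  ... | yes refl | _ rewrite ∣⊥∣≡0 k = m≤n⇒m≤n+o _ 3≤fv
  ... | no _     | yes (_ , fu-empty) rewrite ∣⊥∣≡0 k | fu-empty = ≤-refl
  ... | no _     | no _ = ≤-reflexive (+-identityʳ _)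

  transfer-weight : 3 ≤ ∣ f v ∣ → v ∈ˡ verts D →
    weight D (suc k) transfer + 2 ≤ weight D (suc k) f + ∑ (verts D) (𝟙 ∘ arc? v)
  transfer-weight 3≤fv v∈D = begin
    weight D _ transfer + 2                      ≡⟨ cong (weight D _ transfer +_) (cong (2 *_) 𝟙[v≟v]≡1) ⟨
    weight D _ transfer + 2 * 𝟙 (v ≟ᵥ v)         ≤⟨ ∑-≤-bonus (verts D) (transfer-size 3≤fv) v∈D ⟩
    ∑ (verts D) (λ u → ∣ f u ∣ + 𝟙 (arc? v u))   ≡⟨ ∑-distrib-+ (verts D) _ _ ⟩
    weight D _ f + ∑ (verts D) (𝟙 ∘ arc? v)      ∎
    where open ≤-Reasoning

  transfer-weight+emptyCount : 3 ≤ ∣ f v ∣ → v ∈ˡ verts D →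
    weight D (suc k) transfer + emptyCount D (suc k) transfer + 2
      ≤ weight D (suc k) f + emptyCount D (suc k) f
  transfer-weight+emptyCount 3≤fv v∈D = begin
    weight D _ transfer + emptyCount D _ transfer + 2  ≡⟨ cong₂ _+_ (∑-distrib-+ (verts D) _ _) (cong (2 *_) 𝟙[v≟v]≡1) ⟨
    ∑ (verts D) (cost ∘ transfer) + 2 * 𝟙 (v ≟ᵥ v)     ≤⟨ ∑-≤-bonus (verts D) (transfer-cost 3≤fv) v∈D ⟩
    ∑ (verts D) (cost ∘ f)                             ≡⟨ ∑-distrib-+ (verts D) _ _ ⟩
    weight D _ f + emptyCount D _ f                    ∎
    where open ≤-Reasoning

P-arc-functional : ∀ {m} {i a b : Fin m} → Arc (P m) i a → Arc (P m) i b → a ≡ b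
P-arc-functional i→a i→b = toℕ-injective (trans i→a (sym i→b))

_≟-grid_ : ∀ {m n} → DecidableEquality (V (P m □ P n))
_≟-grid_ = ≡-dec _≟ᶠ_ _≟ᶠ_

grid-arc? : ∀ {m n} (u w : V (P m □ P n)) → Dec (Arc (P m □ P n) u w)
grid-arc? (i , j) (a , b) =
  ((toℕ a ≟ suc (toℕ i)) ×-dec (j ≟ᶠ b)) ⊎-dec ((i ≟ᶠ a) ×-dec (toℕ b ≟ suc (toℕ j)))

grid-outdegree≤2 : ∀ {m n} (v : V (P m □ P n)) →
  ∑ (verts (P m □ P n)) (𝟙 ∘ grid-arc? v) ≤ 2
grid-outdegree≤2 {m} {n} (i , j) = begin
  ∑ grid (𝟙 ∘ grid-arc? (i , j))                ≤⟨ ∑-mono-≤ grid (λ { (a , b) → 𝟙-⊎-dec (down? (a , b)) (right? (a , b)) }) ⟩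
  ∑ grid (λ u → 𝟙 (down? u) + 𝟙 (right? u))     ≡⟨ ∑-distrib-+ grid _ _ ⟩
  ∑ grid (𝟙 ∘ down?) + ∑ grid (𝟙 ∘ right?)      ≤⟨ +-mono-≤ (∑-𝟙-unique≤1 down? down-unique grid-unique)
                                                            (∑-𝟙-unique≤1 right? right-unique grid-unique) ⟩
  2                                             ∎
  where
  open ≤-Reasoning
  grid = verts (P m □ P n)
  grid-unique : Unique grid
  grid-unique = cartesianProduct⁺ (allFin⁺ m) (allFin⁺ n)
  Down Right : Pred (V (P m □ P n)) _
  Down  (a , b) = Arc (P m) i a × j ≡ b
  Right (a , b) = i ≡ a × Arc (P n) j b
  down? : Decidable Down
  down? (a , b) = (toℕ a ≟ suc (toℕ i)) ×-dec (j ≟ᶠ b)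
  right? : Decidable Right
  right? (a , b) = (i ≟ᶠ a) ×-dec (toℕ b ≟ suc (toℕ j))
  down-unique : ∀ {x y} → Down x → Down y → x ≡ y
  down-unique (i→a , refl) (i→a′ , refl) = cong (_, j) (P-arc-functional i→a i→a′)
  right-unique : ∀ {x y} → Right x → Right y → x ≡ y
  right-unique (refl , j→b) (refl , j→b′) = cong (i ,_) (P-arc-functional j→b j→b′)

P-successor : ∀ {m} (i : Fin m) → suc (toℕ i) < m → ∃[ a ] Arc (P m) i a
P-successor i i+1<m = fromℕ< i+1<m , toℕ-fromℕ< i+1<m

lemma4p6 : (n : ℕ) → 3 ≤ n → (f : Labelling (P 3 □ P n) 3) →
    IsGammaTrkFunction (P 3 □ P n) 3 f →
    (∀ g → IsGammaTrkFunction (P 3 □ P n) 3 g →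
      emptyCount (P 3 □ P n) 3 f ≤ emptyCount (P 3 □ P n) 3 g) →
    (i : Fin 3) → toℕ i ≤ 1 → (j : Fin n) → ∣ f (i , j) ∣ ≤ 2
lemma4p6 n _ f f-γ@((f-rdf , f-total) , _) f-fewest i i≤1 j with ∣ f (i , j) ∣ ≤? 2
... | yes fv≤2 = fv≤2
... | no  fv≰2 = ⊥-elim (m+1+n≰m _ (≤-trans transfer-cheaper f-cheapest))
  where
  open Transfer (P 3 □ P n) _≟-grid_ grid-arc? f (i , j)
  3≤fv : 3 ≤ ∣ f (i , j) ∣
  3≤fv = ≰⇒> fv≰2
  v∈grid : (i , j) ∈ˡ verts (P 3 □ P n)
  v∈grid = ∈-cartesianProduct⁺ (∈-allFin i) (∈-allFin j)
  transfer-TkRDF : IsTkRDF (P 3 □ P n) 3 transfer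
  transfer-TkRDF with P-successor i (s≤s (s≤s i≤1))
  ... | a , i→a = transfer-isKRDF f-rdf , transfer-isTotal f-total (inj₁ (i→a , refl))
  lighter : weight (P 3 □ P n) 3 transfer ≤ weight (P 3 □ P n) 3 f
  lighter = +-cancelʳ-≤ 2 _ _
    (≤-trans (transfer-weight 3≤fv v∈grid) (+-monoʳ-≤ _ (grid-outdegree≤2 (i , j))))
  transfer-cheaper : weight (P 3 □ P n) 3 transfer + emptyCount (P 3 □ P n) 3 transfer + 2
                       ≤ weight (P 3 □ P n) 3 f + emptyCount (P 3 □ P n) 3 f
  transfer-cheaper = transfer-weight+emptyCount 3≤fv v∈grid
  f-cheapest : weight (P 3 □ P n) 3 f + emptyCount (P 3 □ P n) 3 f
                           ≤ weight (P 3 □ P n) 3 transfer + emptyCount (P 3 □ P n) 3 transfer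
  f-cheapest = weight+emptyCount-minimal (P 3 □ P n) 3 f-γ f-fewest transfer-TkRDF lighter
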